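{- Let $k\ge3$, $\varepsilon>0$, let $f:S_k\to[k]$ be a one-voter social choice function with $\mathbf{D}(f,\mathrm{NONMANIP}(1,k))\ge\varepsilon$, and let $a\ne b$ be alternatives. With $\bar F$, $B$ and $\partial(B)$ as defined in the context, suppose $\sigma\in\partial(B)$. Then either $\sigma\in\mathrm{LD}(a,b)$, or there exists a $3$-manipulation point $\hat\sigma$ of $f$ which is equal to $\sigma$ or to $[a:b]\sigma$ except that the position of some third alternative $c\notin\{a,b\}$ may be shifted arbitrarily.
   Context: $S_k$ is the set of total orderings of $[k]$. $[a:b]$ exchanges $a$ and $b$ in a ranking where they are adjacent. $\sigma$ is an $r$-manipulation point of $f$ if there is $\sigma'$ obtained from $\sigma$ by permuting at most $r$ alternatives in adjacent positions of $\sigma$ such that $\sigma$ ranks $f(\sigma')$ above $f(\sigma)$. For nonempty $H$, $\mathrm{top}_H$ maps a ranking to its highest-ranked element of $H$; a SCF taking exactly two values $a,b$ is monotone if whenever $f(\sigma)=a$, $f(\sigma')=b$, $\sigma$ ranks $a$ above $b$ and $\sigma'$ ranks $b$ above $a$; $\mathrm{NONMANIP}(1,k)$ is the set of $f$ equal to some $\mathrm{top}_H$ or monotone taking exactly two values; $\mathbf{D}(f,G)=\min_{g\in G}\mathbb{P}(f(\sigma)\ne g(\sigma))$. $\bar F$ is the set of rankings with $a$ immediately above $b$, and $B=\{\sigma\in\bar F: f(\sigma)=a,\ f([a:b]\sigma)=b\}$. In the graph on $\bar F$, $\sigma,\pi$ are adjacent iff $\pi$ arises from $\sigma$ by one adjacent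 transposition treating the block $ab$ as a single element; $\partial(B)$ is the set of $\sigma\in B$ with a neighbor in $\bar F\setminus B$. For $H\subseteq[k]$, $\sigma$ is a local dictator on $H$ ($\sigma\in\mathrm{LD}^H$) if the alternatives of $H$ occupy a block of adjacent positions in $\sigma$ and, for every ranking obtained from $\sigma$ by permuting these alternatives among themselves within the block, $f$ outputs the highest-ranked element of $H$ in that ranking. $\mathrm{LD}(a,b)=\bigcup_{c\notin\{a,b\}}\mathrm{LD}^{\{a,b,c\}}$.
   Formalization: The parameter ε ranges over the positive rationals. -}

module Defs where

open import Data.Nat as ℕ using (ℕ; zero; suc; _+_; _<_; _≤_)
open import Data.Fin using (Fin; fromℕ<; _≟_)
open import Data.Fin.Subset using (Subset; _∈_; ∣_∣; Nonempty; ⁅_⁆; _∪_)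
open import Data.Vec using (Vec; []; _∷_; lookup; toList; map)
open import Data.Vec.Relation.Unary.AllPairs using (AllPairs; allPairs?)
open import Data.List as List using (List; []; _∷_; _++_; filter; length; concatMap)
open import Data.Product using (Σ; ∃; ∃-syntax; _×_; _,_)
open import Data.Sum using (_⊎_)
open import Relation.Binary.PropositionalEquality using (_≡_; _≢_)
open import Relation.Nullary using (¬_; Dec; yes; no)
open import Relation.Nullary.Decidable using (¬?; _×-dec_)
open import Data.Integer using (+_)
open import Data.Rational as ℚ using (ℚ)

-- A ranking of [k] = Fin k is a duplicate-free vector of
-- length k; position 0 is the top (most preferred) position.
-- SCFs are defined on all vectors, but only their values on rankings
-- ever matter in the definitions below.

Vote : ℕ → Set
Vote k = Vec (Fin k) k

IsRanking : ∀ {k} → Vote k → Set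
IsRanking σ = AllPairs _≢_ σ

isRanking? : ∀ {k} (σ : Vote k) → Dec (IsRanking σ)
isRanking? σ = allPairs? (λ x y → ¬? (x ≟ y)) σ

SCF : ℕ → Set
SCF k = Vote k → Fin k

At : ∀ {k} → Vote k → ℕ → Fin k → Set
At {k} σ n x = Σ (n < k) (λ p → lookup σ (fromℕ< p) ≡ x)

Above : ∀ {k} → Vote k → Fin k → Fin k → Set
Above σ x y = ∃[ i ] ∃[ j ] (i < j × At σ i x × At σ j y)

-- σ' is obtained from σ by permuting (at most r) alternatives lying in
-- the window of r adjacent positions i, …, i+r-1
AdjPerm : ∀ {k} → ℕ → Vote k → Vote k → Set
AdjPerm {k} r σ σ' =
  IsRanking σ' × ∃[ i ] (∀ (j : ℕ) (x : Fin k) → (j < i ⊎ i + r ≤ j) →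
                           At σ j x → At σ' j x)

ManipPoint : ∀ {k} → ℕ → SCF k → Vote k → Set
ManipPoint r f σ =
  IsRanking σ × ∃[ σ' ] (AdjPerm r σ σ' × Above σ (f σ') (f σ))

IsTop : ∀ {k} → Subset k → Vote k → Fin k → Set
IsTop H σ x = x ∈ H × (∀ y → y ∈ H → y ≢ x → Above σ x y)

IsTopH : ∀ {k} → SCF k → Set
IsTopH {k} g = Σ (Subset k) (λ H → Nonempty H ×
                 (∀ σ → IsRanking σ → IsTop H σ (g σ)))

MonotoneTwoValued : ∀ {k} → SCF k → Set
MonotoneTwoValued {k} g = ∃[ a ] ∃[ b ] (a ≢ b
  × (∀ σ → IsRanking σ → g σ ≡ a ⊎ g σ ≡ b)
  × (∃[ σ ] (IsRanking σ × g σ ≡ a))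
  × (∃[ σ ] (IsRanking σ × g σ ≡ b))
  × (∀ σ σ' → IsRanking σ → IsRanking σ' → g σ ≡ a → g σ' ≡ b →
       Above σ a b × Above σ' b a))

NONMANIP : ∀ {k} → SCF k → Set
NONMANIP g = IsTopH g ⊎ MonotoneTwoValued g

-- Uniform probability on S_k via counting.

allVecs : ∀ m n → List (Vec (Fin m) n)
allVecs m zero = [] ∷ []
allVecs m (suc n) = concatMap (λ v → List.map (_∷ v) (List.allFin m)) (allVecs m n)

rankings : ∀ k → List (Vote k)
rankings k = filter isRanking? (allVecs k k)

disagree : ∀ {k} → SCF k → SCF k → ℕ
disagree f g = length (filter (λ σ → ¬? (f σ ≟ g σ)) (rankings _))

toℚ : ℕ → ℚ
toℚ n = ℚ._/_ (+ n) 1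

-- D(f, NONMANIP(1,k)) ≥ ε : every g in NONMANIP(1,k) disagrees with f
-- with probability ≥ ε (uniform σ ∈ S_k).
DistNonManipGE : ∀ {k} → SCF k → ℚ → Set
DistNonManipGE {k} f ε = ∀ (g : SCF k) → NONMANIP g →
  ε ℚ.* toℚ (length (rankings k)) ℚ.≤ toℚ (disagree f g)

swapVal : ∀ {k} → Fin k → Fin k → Fin k → Fin k
swapVal a b x with x ≟ a | x ≟ b
... | yes _ | _ = b
... | no _ | yes _ = a
... | no _ | no _ = x

[_∶_] : ∀ {k} → Fin k → Fin k → Vote k → Vote k
[ a ∶ b ] σ = map (swapVal a b) σ

Fbar : ∀ {k} → Fin k → Fin k → Vote k → Set
Fbar a b σ = IsRanking σ × ∃[ i ] (At σ i a × At σ (suc i) b)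

Bset : ∀ {k} → SCF k → Fin k → Fin k → Vote k → Set
Bset f a b σ = Fbar a b σ × f σ ≡ a × f ([ a ∶ b ] σ) ≡ b

delete : ∀ {k} → Fin k → Vote k → List (Fin k)
delete c σ = filter (λ x → ¬? (x ≟ c)) (toList σ)

AdjSwapL : ∀ {A : Set} → List A → List A → Set
AdjSwapL {A} l l' = ∃[ xs ] ∃[ x ] ∃[ y ] ∃[ ys ]
  (l ≡ xs ++ x ∷ y ∷ ys × l' ≡ xs ++ y ∷ x ∷ ys)

-- adjacency in the graph on F̄: contracting the block ab to the single
-- element a (i.e. deleting b), π arises from σ by one adjacent transposition
FbarAdj : ∀ {k} → Fin k → Fin k → Vote k → Vote k → Set
FbarAdj a b σ π = Fbar a b σ × Fbar a b π × AdjSwapL (delete b σ) (delete b π)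

∂B : ∀ {k} → SCF k → Fin k → Fin k → Vote k → Set
∂B f a b σ = Bset f a b σ × ∃[ π ] (FbarAdj a b σ π × ¬ Bset f a b π)

LDon : ∀ {k} → SCF k → Subset k → Vote k → Set
LDon {k} f H σ = ∃[ i ]
  ( (∀ x → x ∈ H → ∃[ j ] (i ≤ j × j < i + ∣ H ∣ × At σ j x))
  × (∀ τ → IsRanking τ →
       (∀ (j : ℕ) (x : Fin k) → (j < i ⊎ i + ∣ H ∣ ≤ j) → At σ j x → At τ j x) →
       IsTop H τ (f τ)))

LDab : ∀ {k} → SCF k → Fin k → Fin k → Vote k → Set
LDab f a b σ = ∃[ c ] (c ≢ a × c ≢ b × LDon f (⁅ a ⁆ ∪ ⁅ b ⁆ ∪ ⁅ c ⁆) σ)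

module Submission where

-- The central tool is the window lemma
-- (`window-lemma`): if τ and τ' differ only inside a window of at most three adjacent
-- positions, then f τ ≡ f τ', or one of τ, τ' is a 3-manipulation point, or the two
-- outcomes both lie inside the window and τ, τ' order them oppositely.  Its corollaries
-- (`keeps-outcome` and variants) say that f τ' persists on τ when it sits outside the
-- window of τ or at its top.
--
-- The neighbour π ∉ B of σ in F̄ arises by one adjacent transposition of the contracted
-- ranking, which leaves three shapes (`edge-shape`): the transposed pair lies away from
-- the block ab, the block rises above some x, or a third alternative c rises above the
-- block.  In the first two shapes, the window lemma applied to (π, σ) and ([a:b]π, [a:b]σ)
-- forces π ∈ B unless a manipulation point appears.  In the third, it shows that f elects
-- the top of the window for all six arrangements of a, b, c, which makes σ a local
-- dictator on {a, b, c} (`window-dictator`).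

module Proof where
  open import Defs
  open import Data.Nat as ℕ using (ℕ; suc; _+_; _≤_; _<_; z≤n; s≤s; _<?_)
  open import Data.Nat.Properties
  open import Data.Fin as F using (Fin; toℕ; fromℕ<)
  import Data.Fin.Properties as FP
  open import Data.Fin.Subset as S using (Subset; ⁅_⁆; _∪_; ∣_∣)
  import Data.Fin.Subset.Properties as SP
  open import Data.Vec as V using (Vec; []; _∷_; lookup; toList)
  import Data.Vec.Base as VB
  import Data.Vec.Properties as VP
  open import Data.Vec.Relation.Binary.Equality.Cast using (cast-is-id)
  import Data.Vec.Relation.Unary.All as VAll
  import Data.Vec.Relation.Unary.AllPairs as VAP
  open import Data.List as L using (List; []; _∷_; _++_; length; filter)
  import Data.List.Properties as LP
  open import Data.List.Relation.Unary.All as LAll using (All)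
  import Data.List.Relation.Unary.AllPairs as LAP
  import Data.List.Relation.Unary.AllPairs.Properties as LAPP
  open import Data.Bool using (true; false)
  open import Data.Product using (Σ; ∃-syntax; _×_; _,_; proj₁; proj₂)
  open import Data.Sum using (_⊎_; inj₁; inj₂)
  open import Data.Empty using (⊥; ⊥-elim)
  open import Function using (_∘_)
  open import Relation.Binary using (tri<; tri≈; tri>)
  open import Relation.Binary.PropositionalEquality
  open import Relation.Nullary using (¬_; Dec; yes; no)
  open import Relation.Nullary.Decidable using (¬?)

  data AtL {A : Set} : List A → ℕ → A → Set where
    here  : ∀ {x l} → AtL (x ∷ l) 0 x
    there : ∀ {y l n x} → AtL l n x → AtL (y ∷ l) (suc n) x

  Occurs : ∀ {A : Set} → A → List A → Set
  Occurs x l = ∃[ n ] AtL l n x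

  Uniq : ∀ {A : Set} → List A → Set
  Uniq l = ∀ {n m x} → AtL l n x → AtL l m x → n ≡ m

  AboveL : ∀ {A : Set} → List A → A → A → Set
  AboveL l x y = ∃[ i ] ∃[ j ] (i < j × AtL l i x × AtL l j y)

  Outside : ℕ → ℕ → ℕ → Set
  Outside lo w n = n < lo ⊎ lo + w ≤ n

  module _ {A : Set} where

    along : ∀ {l l' : List A} {n x} → l ≡ l' → AtL l n x → AtL l' n x
    along refl p = p

    atL-functional : ∀ {l : List A} {n x y} → AtL l n x → AtL l n y → x ≡ y
    atL-functional here here = refl
    atL-functional (there p) (there q) = atL-functional p q

    untail : ∀ {y} {l : List A} {n x} → AtL (y ∷ l) (suc n) x → AtL l n x
    untail (there p) = p

    atL-bound : ∀ {l : List A} {n x} → AtL l n x → n < length l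
    atL-bound here = s≤s z≤n
    atL-bound (there p) = s≤s (atL-bound p)

    atL-++ˡ : ∀ {L M : List A} {n x} → AtL L n x → AtL (L ++ M) n x
    atL-++ˡ here = here
    atL-++ˡ (there p) = there (atL-++ˡ p)

    atL-++ʳ : ∀ (L : List A) {M n x} → AtL M n x → AtL (L ++ M) (length L + n) x
    atL-++ʳ [] p = p
    atL-++ʳ (_ ∷ L) p = there (atL-++ʳ L p)

    atL-++⁻ : ∀ (L : List A) {M n x} → AtL (L ++ M) n x →
              (n < length L × AtL L n x) ⊎ (∃[ m ] (n ≡ length L + m × AtL M m x))
    atL-++⁻ [] p = inj₂ (_ , refl , p)
    atL-++⁻ (y ∷ L) here = inj₁ (s≤s z≤n , here)
    atL-++⁻ (y ∷ L) (there p) with atL-++⁻ L p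
    ... | inj₁ (lt , q) = inj₁ (s≤s lt , there q)
    ... | inj₂ (m , eq , q) = inj₂ (m , cong suc eq , q)

    atL-ext : ∀ (l m : List A) → length l ≡ length m →
              (∀ n x → AtL l n x → AtL m n x) → l ≡ m
    atL-ext [] [] _ _ = refl
    atL-ext (x ∷ l) (y ∷ m) len h =
      cong₂ _∷_ (atL-functional (h 0 x here) here)
                (atL-ext l m (cong ℕ.pred len) (λ n z p → untail (h (suc n) z (there p))))

    uniq-apart : ∀ {l : List A} {n m x y} → Uniq l → AtL l n x → AtL l m y → n ≢ m → x ≢ y
    uniq-apart U p q n≢m refl = n≢m (U p q)

  atL-map : ∀ {A B : Set} (g : A → B) {l n x} → AtL l n x → AtL (L.map g l) n (g x)
  atL-map g here = here
  atL-map g (there p) = there (atL-map g p)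

  module _ {A : Set} where

    outside-transfer : ∀ (L W W' R : List A) → length W ≡ length W' → ∀ {n x} →
                       Outside (length L) (length W) n → AtL (L ++ W ++ R) n x → AtL (L ++ W' ++ R) n x
    outside-transfer L W W' R len {n} {x} out p with atL-++⁻ L p
    ... | inj₁ (_ , q) = atL-++ˡ q
    ... | inj₂ (m , refl , q) with out
    ...   | inj₁ n<L = ⊥-elim (m+n≮m (length L) m n<L)
    ...   | inj₂ L+W≤n with atL-++⁻ W q
    ...     | inj₁ (m<W , _) = ⊥-elim (<⇒≱ (+-monoʳ-< (length L) m<W) L+W≤n)
    ...     | inj₂ (m' , refl , r) =
                subst (λ w → AtL (L ++ W' ++ R) (length L + (w + m')) x) (sym len)
                      (atL-++ʳ L (atL-++ʳ W' r))

    reversal-inside : ∀ (L W W' R : List A) → length W ≡ length W' →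
      Uniq (L ++ W ++ R) → Uniq (L ++ W' ++ R) → ∀ {x y q p q' p'} →
      q < p → AtL (L ++ W ++ R) q x → AtL (L ++ W ++ R) p y →
      p' < q' → AtL (L ++ W' ++ R) q' x → AtL (L ++ W' ++ R) p' y →
      length L ≤ q × p < length L + length W
    reversal-inside L W W' R len U U' {q = q} {p} {q'} {p'} q<p qx py p'<q' qx' py' = lower , upper
      where
        lower : length L ≤ q
        lower with q <? length L
        ... | no q≮L = ≮⇒≥ q≮L
        ... | yes q<L = ⊥-elim (<-asym q<p (subst (_< q) (sym p≡p') p'<q))
          where
            p'<q : p' < q
            p'<q = subst (p' <_) (U' qx' (outside-transfer L W W' R len (inj₁ q<L) qx)) p'<q'
            p≡p' : p ≡ p'
            p≡p' = U py (outside-transfer L W' W R (sym len) (inj₁ (<-trans p'<q q<L)) py')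
        upper : p < length L + length W
        upper with p <? length L + length W
        ... | yes p<end = p<end
        ... | no p≮end = ⊥-elim (<-asym q<p (subst (p <_) (sym q≡q') p<q'))
          where
            end≤p : length L + length W ≤ p
            end≤p = ≮⇒≥ p≮end
            p<q' : p < q'
            p<q' = subst (_< q') (U' py' (outside-transfer L W W' R len (inj₂ end≤p) py)) p'<q'
            q≡q' : q ≡ q'
            q≡q' = U qx (outside-transfer L W' W R (sym len)
                           (inj₂ (subst (λ w → length L + w ≤ q') len (≤-trans end≤p (<⇒≤ p<q')))) qx')

    window-vs-front : ∀ (L W R : List A) → Uniq (L ++ W ++ R) → ∀ {n i z w} →
                      AtL L n z → AtL W i w → z ≢ w
    window-vs-front L W R U p q =
      uniq-apart U (atL-++ˡ p) (atL-++ʳ L (atL-++ˡ q))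
                 (λ e → <⇒≱ (atL-bound p) (subst (length L ≤_) (sym e) (m≤m+n (length L) _)))

    window-vs-back : ∀ (L W R : List A) → Uniq (L ++ W ++ R) → ∀ {n i z w} →
                     AtL R n z → AtL W i w → z ≢ w
    window-vs-back L W R U p q =
      uniq-apart U (atL-++ʳ L (atL-++ʳ W p)) (atL-++ʳ L (atL-++ˡ q))
                 (λ e → <⇒≱ (atL-bound q) (subst (length W ≤_) (+-cancelˡ-≡ (length L) _ _ e) (m≤m+n (length W) _)))

    window-vs-window : ∀ (L W R : List A) → Uniq (L ++ W ++ R) → ∀ {i j u v} →
                       AtL W i u → AtL W j v → i ≢ j → u ≢ v
    window-vs-window L W R U p q i≢j =
      uniq-apart U (atL-++ʳ L (atL-++ˡ p)) (atL-++ʳ L (atL-++ˡ q)) (i≢j ∘ +-cancelˡ-≡ (length L) _ _)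

    splice : ∀ (L W R T : List A) → length T ≡ length (L ++ W ++ R) →
             (∀ n x → Outside (length L) (length W) n → AtL (L ++ W ++ R) n x → AtL T n x) →
             ∃[ W' ] (length W' ≡ length W × T ≡ L ++ W' ++ R)
    splice (l ∷ L) W R (t ∷ T) len agree
      with splice L W R T (cong ℕ.pred len) (λ n x out p → untail (agree (suc n) x (shift out) (there p)))
      where
        shift : ∀ {n} → Outside (length L) (length W) n → Outside (suc (length L)) (length W) (suc n)
        shift (inj₁ n<L) = inj₁ (s≤s n<L)
        shift (inj₂ end≤n) = inj₂ (s≤s end≤n)
    ... | W' , width , refl = W' , width , cong (_∷ _) (atL-functional here (agree 0 l (inj₁ (s≤s z≤n)) here))
    splice [] (w ∷ W) R (t ∷ T) len agree
      with splice [] W R T (cong ℕ.pred len) (λ n x out p → untail (agree (suc n) x (shift out) (there p)))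
      where
        shift : ∀ {n} → Outside 0 (length W) n → Outside 0 (suc (length W)) (suc n)
        shift (inj₂ W≤n) = inj₂ (s≤s W≤n)
    ... | W' , width , refl = t ∷ W' , cong suc width , refl
    splice [] [] R T len agree = [] , refl , sym (atL-ext R T (sym len) (λ n x → agree n x (inj₂ z≤n)))

    window-members : ∀ (L W W' R : List A) → length W ≡ length W' → Uniq (L ++ W' ++ R) →
                     ∀ {z} → Occurs z (L ++ W ++ R) → Occurs z W' → Occurs z W
    window-members L W W' R len U' (p , zp) (i , zi) with atL-++⁻ L zp
    ... | inj₁ (p<L , zL) =
            ⊥-elim (<⇒≱ p<L (subst (length L ≤_) (sym (U' (atL-++ˡ zL) (atL-++ʳ L (atL-++ˡ zi)))) (m≤m+n _ _)))
    ... | inj₂ (m , refl , zWR) with atL-++⁻ W zWR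
    ...   | inj₁ (_ , zW) = m , zW
    ...   | inj₂ (m' , refl , zR) =
            ⊥-elim (<⇒≱ (atL-bound zi) (subst (length W' ≤_) W'+m'≡i (m≤m+n (length W') m')))
      where
        W'+m'≡i : length W' + m' ≡ i
        W'+m'≡i = +-cancelˡ-≡ (length L) _ _ (U' (atL-++ʳ L (atL-++ʳ W' zR)) (atL-++ʳ L (atL-++ˡ zi)))

  module _ {A : Set} where

    all-at : ∀ {P : A → Set} {l n x} → All P l → AtL l n x → P x
    all-at (px LAll.∷ _) here = px
    all-at (_ LAll.∷ ps) (there q) = all-at ps q

    allPairs⇒uniq : ∀ {l : List A} → LAP.AllPairs _≢_ l → Uniq l
    allPairs⇒uniq (_ LAP.∷ _) here here = refl
    allPairs⇒uniq (x∉ LAP.∷ _) here (there q) = ⊥-elim (all-at x∉ q refl)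
    allPairs⇒uniq (x∉ LAP.∷ _) (there p) here = ⊥-elim (all-at x∉ p refl)
    allPairs⇒uniq (_ LAP.∷ ps) (there p) (there q) = cong suc (allPairs⇒uniq ps p q)

    vec-allPairs⇒list : ∀ {n} {v : Vec A n} → VAP.AllPairs _≢_ v → LAP.AllPairs _≢_ (toList v)
    vec-allPairs⇒list VAP.[] = LAP.[]
    vec-allPairs⇒list (px VAP.∷ ps) = all⇒all px LAP.∷ vec-allPairs⇒list ps
      where
        all⇒all : ∀ {x m} {w : Vec A m} → VAll.All (x ≢_) w → All (x ≢_) (toList w)
        all⇒all VAll.[] = LAll.[]
        all⇒all (p VAll.∷ ps) = p LAll.∷ all⇒all ps

    lookup⇒atL : ∀ {m} (v : Vec A m) (i : Fin m) → AtL (toList v) (toℕ i) (lookup v i)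
    lookup⇒atL (x ∷ v) F.zero = here
    lookup⇒atL (x ∷ v) (F.suc i) = there (lookup⇒atL v i)

    atL⇒lookup : ∀ {m} (v : Vec A m) {n x} → AtL (toList v) n x → Σ (n < m) λ n<m → lookup v (fromℕ< n<m) ≡ x
    atL⇒lookup (x ∷ v) here = s≤s z≤n , refl
    atL⇒lookup (y ∷ v) (there p) with atL⇒lookup v p
    ... | n<m , e = s≤s n<m , e

  module _ {k : ℕ} where

    at⇒atL : ∀ {σ : Vote k} {n x} → At σ n x → AtL (toList σ) n x
    at⇒atL {σ} (n<k , e) = subst₂ (AtL (toList σ)) (FP.toℕ-fromℕ< n<k) e (lookup⇒atL σ (fromℕ< n<k))

    atL⇒at : ∀ {σ : Vote k} {n x} → AtL (toList σ) n x → At σ n x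
    atL⇒at {σ} p = atL⇒lookup σ p

    aboveL⇒above : ∀ {σ : Vote k} {x y} → AboveL (toList σ) x y → Above σ x y
    aboveL⇒above (i , j , i<j , p , q) = i , j , i<j , atL⇒at p , atL⇒at q

  ranking-unique : ∀ {k} {σ : Vote k} → IsRanking σ → Uniq (toList σ)
  ranking-unique r = allPairs⇒uniq (vec-allPairs⇒list r)

  -- the k entries of a ranking cannot all avoid an alternative x: they would lie
  -- in Fin k minus one point, and the pigeonhole principle would give a repetition
  ranking-hits : ∀ k (σ : Vote k) → IsRanking σ → (x : Fin k) → ¬ ¬ (∃[ i ] lookup σ i ≡ x)
  ranking-hits (suc m) σ r x x∉σ
    with FP.pigeonhole (n<1+n m) (λ i → F.punchOut {i = x} {j = lookup σ i} (λ e → x∉σ (i , sym e)))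
  ... | i , j , i<j , e = FP.<⇒≢ i<j (FP.toℕ-injective (ranking-unique r (lookup⇒atL σ i)
          (subst (AtL (toList σ) (toℕ j))
                 (sym (FP.punchOut-injective {i = x} (λ e₁ → x∉σ (i , sym e₁)) (λ e₁ → x∉σ (j , sym e₁)) e))
                 (lookup⇒atL σ j))))

  ranking-complete : ∀ {k} {σ : Vote k} → IsRanking σ → ∀ x → Occurs x (toList σ)
  ranking-complete {k} {σ} r x with FP.any? (λ i → lookup σ i F.≟ x)
  ... | yes (i , e) = toℕ i , subst (AtL (toList σ) (toℕ i)) e (lookup⇒atL σ i)
  ... | no x∉σ = ⊥-elim (ranking-hits k σ r x x∉σ)

  record Window {k} (τ τ' : Vote k) : Set where
    constructor window
    field
      pre mid mid' post : List (Fin k)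
      shape  : toList τ ≡ pre ++ mid ++ post
      shape' : toList τ' ≡ pre ++ mid' ++ post
      same-width : length mid ≡ length mid'
      narrow : length mid ≤ 3
  open Window

  module _ {k} {τ τ' : Vote k} where

    window-sym : Window τ τ' → Window τ' τ
    window-sym (window L W W' R e e' len w≤3) = window L W' W R e' e (sym len) (subst (_≤ 3) len w≤3)

    window⇒adjPerm : Window τ τ' → IsRanking τ' → AdjPerm 3 τ τ'
    window⇒adjPerm (window L W W' R e e' len w≤3) r' = r' , length L , λ j x out p →
        atL⇒at (along (sym e') (outside-transfer L W W' R len (within-3 out) (along e (at⇒atL p))))
      where
        within-3 : ∀ {j} → Outside (length L) 3 j → Outside (length L) (length W) j
        within-3 (inj₁ j<L) = inj₁ j<L
        within-3 (inj₂ end≤j) = inj₂ (≤-trans (+-monoʳ-≤ (length L) w≤3) end≤j)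

  module _ {k} (f : SCF k) where

    manipulation : ∀ {τ τ' : Vote k} → Window τ τ' → IsRanking τ → IsRanking τ' →
                   AboveL (toList τ) (f τ') (f τ) → ManipPoint 3 f τ
    manipulation w r r' above = r , _ , window⇒adjPerm w r' , aboveL⇒above above

    ReversedInside : ∀ {τ τ' : Vote k} → Window τ τ' → Set
    ReversedInside {τ} {τ'} w = ∃[ q ] ∃[ p ]
      (length (pre w) ≤ q × q < p × p < length (pre w) + length (mid w)
       × AtL (toList τ) q (f τ) × AtL (toList τ) p (f τ'))

    -- Window lemma: unless f τ ≡ f τ' or one of τ, τ' is a manipulation point, the two
    -- rankings order the two outcomes differently, which can only happen inside the window.
    window-lemma : ∀ {τ τ' : Vote k} (w : Window τ τ') → IsRanking τ → IsRanking τ' →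
                   f τ ≡ f τ' ⊎ ManipPoint 3 f τ ⊎ ManipPoint 3 f τ' ⊎ ReversedInside w
    window-lemma {τ} {τ'} w@(window L W W' R e e' len _) r r'
      with ranking-complete r (f τ) | ranking-complete r (f τ') | ranking-complete r' (f τ) | ranking-complete r' (f τ')
    ... | q , qx | p , py | q' , qx' | p' , py' with <-cmp q p
    ... | tri≈ _ refl _ = inj₁ (atL-functional qx py)
    ... | tri> _ _ p<q = inj₂ (inj₁ (manipulation w r r' (p , q , p<q , py , qx)))
    ... | tri< q<p _ _ with <-cmp q' p'
    ...   | tri≈ _ refl _ = inj₁ (atL-functional qx' py')
    ...   | tri< q'<p' _ _ = inj₂ (inj₂ (inj₁ (manipulation (window-sym w) r' r (q' , p' , q'<p' , qx' , py'))))
    ...   | tri> _ _ p'<q' = inj₂ (inj₂ (inj₂ (q , p , L≤q , q<p , p<end , qx , py)))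
      where
        reversal : length L ≤ q × p < length L + length W
        reversal = reversal-inside L W W' R len (subst Uniq e (ranking-unique r)) (subst Uniq e' (ranking-unique r'))
                     q<p (along e qx) (along e py) p'<q' (along e' qx') (along e' py')
        L≤q : length L ≤ q
        L≤q = proj₁ reversal
        p<end : p < length L + length W
        p<end = proj₂ reversal

    keeps-outcome : ∀ {τ τ' : Vote k} (w : Window τ τ') → IsRanking τ → IsRanking τ' → ∀ {y p} →
                    f τ' ≡ y → AtL (toList τ) p y → p ≤ length (pre w) ⊎ length (pre w) + length (mid w) ≤ p →
                    f τ ≡ y ⊎ ManipPoint 3 f τ ⊎ ManipPoint 3 f τ'
    keeps-outcome w r r' refl py placement with window-lemma w r r'
    ... | inj₁ e = inj₁ e
    ... | inj₂ (inj₁ m) = inj₂ (inj₁ m)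
    ... | inj₂ (inj₂ (inj₁ m)) = inj₂ (inj₂ m)
    ... | inj₂ (inj₂ (inj₂ (q , p , L≤q , q<p , p<end , _ , py'))) with ranking-unique r py py' | placement
    ...   | refl | inj₁ p≤L = ⊥-elim (<-irrefl refl (<-≤-trans q<p (≤-trans p≤L L≤q)))
    ...   | refl | inj₂ end≤p = ⊥-elim (<-irrefl refl (<-≤-trans p<end end≤p))

    keeps-outside-outcome : ∀ {τ τ' : Vote k} (w : Window τ τ') → IsRanking τ → IsRanking τ' → ∀ {y} →
                            f τ' ≡ y → Occurs y (pre w) ⊎ Occurs y (post w) →
                            f τ ≡ y ⊎ ManipPoint 3 f τ ⊎ ManipPoint 3 f τ'
    keeps-outside-outcome w r r' fy (inj₁ (n , yn)) =
      keeps-outcome w r r' fy (along (sym (shape w)) (atL-++ˡ yn)) (inj₁ (<⇒≤ (atL-bound yn)))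
    keeps-outside-outcome w r r' fy (inj₂ (n , yn)) =
      keeps-outcome w r r' fy (along (sym (shape w)) (atL-++ʳ (pre w) (atL-++ʳ (mid w) yn)))
                    (inj₂ (+-monoʳ-≤ (length (pre w)) (m≤m+n _ n)))

    keeps-top-outcome : ∀ {τ τ' : Vote k} (w : Window τ τ') → IsRanking τ → IsRanking τ' → ∀ {y} →
                        f τ' ≡ y → AtL (mid w) 0 y → f τ ≡ y ⊎ ManipPoint 3 f τ ⊎ ManipPoint 3 f τ'
    keeps-top-outcome w r r' fy y-top =
      keeps-outcome w r r' fy (along (sym (shape w)) (atL-++ʳ (pre w) (atL-++ˡ y-top)))
                    (inj₁ (≤-reflexive (+-identityʳ _)))

    keeps-second-outcome : ∀ {τ τ' : Vote k} (w : Window τ τ') → IsRanking τ → IsRanking τ' → ∀ {y t} →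
                           f τ' ≡ y → AtL (mid w) 1 y → AtL (mid w) 0 t →
                           (f τ ≡ y ⊎ f τ ≡ t) ⊎ ManipPoint 3 f τ ⊎ ManipPoint 3 f τ'
    keeps-second-outcome w r r' refl y-second t-top with window-lemma w r r'
    ... | inj₁ e = inj₁ (inj₁ e)
    ... | inj₂ (inj₁ m) = inj₂ (inj₁ m)
    ... | inj₂ (inj₂ (inj₁ m)) = inj₂ (inj₂ m)
    ... | inj₂ (inj₂ (inj₂ (q , p , L≤q , q<p , _ , qx , py)))
      with ranking-unique r py (along (sym (shape w)) (atL-++ʳ (pre w) (atL-++ˡ y-second)))
    ...   | refl = inj₁ (inj₂ (atL-functional qx (subst (λ n → AtL (toList _) n _) (sym q≡L) t-at)))
      where
        t-at : AtL (toList _) (length (pre w) + 0) _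
        t-at = along (sym (shape w)) (atL-++ʳ (pre w) (atL-++ˡ t-top))
        q≡L : q ≡ length (pre w) + 0
        q≡L = trans (≤-antisym (≤-pred (subst (suc q ≤_) (+-comm (length (pre w)) 1) q<p)) L≤q) (sym (+-identityʳ _))

  module _ {k} (u v : Fin k) where

    private
      sw : Fin k → Fin k
      sw = swapVal u v

    swap-left : sw u ≡ v
    swap-left with u F.≟ u
    ... | yes _ = refl
    ... | no u≢u = ⊥-elim (u≢u refl)

    swap-right : sw v ≡ u
    swap-right with v F.≟ u | v F.≟ v
    ... | yes v≡u | _ = v≡u
    ... | no _ | yes _ = refl
    ... | no _ | no v≢v = ⊥-elim (v≢v refl)

    swap-other : ∀ {z} → z ≢ u → z ≢ v → sw z ≡ z
    swap-other {z} z≢u z≢v with z F.≟ u | z F.≟ v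
    ... | yes z≡u | _ = ⊥-elim (z≢u z≡u)
    ... | no _ | yes z≡v = ⊥-elim (z≢v z≡v)
    ... | no _ | no _ = refl

    swap-involutive : ∀ z → sw (sw z) ≡ z
    swap-involutive z = by-cases (z F.≟ u) (z F.≟ v)
      where
        by-cases : Dec (z ≡ u) → Dec (z ≡ v) → sw (sw z) ≡ z
        by-cases (yes refl) _ = trans (cong sw swap-left) swap-right
        by-cases (no _) (yes refl) = trans (cong sw swap-right) swap-left
        by-cases (no z≢u) (no z≢v) = trans (cong sw (swap-other z≢u z≢v)) (swap-other z≢u z≢v)

    swap-injective : ∀ {x y} → sw x ≡ sw y → x ≡ y
    swap-injective {x} {y} e = trans (sym (swap-involutive x)) (trans (cong sw e) (swap-involutive y))

    swap-ranking : ∀ {σ : Vote k} → IsRanking σ → IsRanking ([ u ∶ v ] σ)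
    swap-ranking = map-distinct
      where
        map-apart : ∀ {x m} {w : Vec (Fin k) m} → VAll.All (x ≢_) w → VAll.All (sw x ≢_) (V.map sw w)
        map-apart VAll.[] = VAll.[]
        map-apart (p VAll.∷ ps) = (p ∘ swap-injective) VAll.∷ map-apart ps
        map-distinct : ∀ {m} {w : Vec (Fin k) m} → VAP.AllPairs _≢_ w → VAP.AllPairs _≢_ (V.map sw w)
        map-distinct VAP.[] = VAP.[]
        map-distinct (px VAP.∷ ps) = map-apart px VAP.∷ map-distinct ps

    swap-toList : ∀ (σ : Vote k) → toList ([ u ∶ v ] σ) ≡ L.map sw (toList σ)
    swap-toList σ = VP.toList-map sw σ

  map-++-++ : ∀ {A B : Set} (g : A → B) (L W R : List A) →
              L.map g (L ++ W ++ R) ≡ L.map g L ++ L.map g W ++ L.map g R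
  map-++-++ g L W R = trans (LP.map-++ g L (W ++ R)) (cong (L.map g L ++_) (LP.map-++ g W R))

  map-triple : ∀ {A B : Set} (g : A → B) (x y z : A) {x' y' z'} → g x ≡ x' → g y ≡ y' → g z ≡ z' →
               L.map g (x ∷ y ∷ z ∷ []) ≡ x' ∷ y' ∷ z' ∷ []
  map-triple g x y z refl refl refl = refl

  swap-split : ∀ {k} (u v : Fin k) {ρ : Vote k} (L W R : List (Fin k)) → toList ρ ≡ L ++ W ++ R →
               toList ([ u ∶ v ] ρ) ≡ L.map (swapVal u v) L ++ L.map (swapVal u v) W ++ L.map (swapVal u v) R
  swap-split u v {ρ} L W R e = trans (swap-toList u v ρ) (trans (cong (L.map (swapVal u v)) e) (map-++-++ _ L W R))

  swap-inside : ∀ {k} {ρ : Vote k} (L W R : List (Fin k)) {u v} → Uniq (L ++ W ++ R) → toList ρ ≡ L ++ W ++ R →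
                Occurs u W → Occurs v W → toList ([ u ∶ v ] ρ) ≡ L ++ L.map (swapVal u v) W ++ R
  swap-inside L W R {u} {v} U e (i , ui) (j , vj) =
    trans (swap-split u v L W R e)
          (cong₂ (λ l r → l ++ L.map (swapVal u v) W ++ r)
                 (map-fixed L (λ zn → swap-other u v (window-vs-front L W R U zn ui) (window-vs-front L W R U zn vj)))
                 (map-fixed R (λ zn → swap-other u v (window-vs-back L W R U zn ui) (window-vs-back L W R U zn vj))))
    where
      map-fixed : ∀ l → (∀ {n z} → AtL l n z → swapVal u v z ≡ z) → L.map (swapVal u v) l ≡ l
      map-fixed [] _ = refl
      map-fixed (x ∷ l) fix = cong₂ _∷_ (fix here) (map-fixed l (fix ∘ there))

  deleteL : ∀ {k} → Fin k → List (Fin k) → List (Fin k)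
  deleteL c = filter (λ x → ¬? (x F.≟ c))

  module _ {k} (c : Fin k) where

    private
      keep? : ∀ x → Dec (x ≢ c)
      keep? x = ¬? (x F.≟ c)

    delete-one : ∀ {P Q : List (Fin k)} → All (_≢ c) P → All (_≢ c) Q → deleteL c (P ++ c ∷ Q) ≡ P ++ Q
    delete-one {P} {Q} P∌c Q∌c =
      trans (LP.filter-++ keep? P (c ∷ Q))
            (cong₂ _++_ (LP.filter-all keep? P∌c)
                        (trans (LP.filter-reject keep? (λ c≢c → c≢c refl)) (LP.filter-all keep? Q∌c)))

    delete-unique : ∀ (P Q : List (Fin k)) → Uniq (P ++ c ∷ Q) → deleteL c (P ++ c ∷ Q) ≡ P ++ Q
    delete-unique P Q U = delete-one (absent-from P before) (absent-from Q after)
      where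
        absent-from : ∀ l → (∀ {n z} → AtL l n z → z ≢ c) → All (_≢ c) l
        absent-from [] _ = LAll.[]
        absent-from (x ∷ l) h = h here LAll.∷ absent-from l (h ∘ there)
        c-at : AtL (P ++ c ∷ Q) (length P + 0) c
        c-at = atL-++ʳ P here
        before : ∀ {n z} → AtL P n z → z ≢ c
        before zn = uniq-apart U (atL-++ˡ zn) c-at
                      (λ e → <-irrefl (trans e (+-identityʳ _)) (atL-bound zn))
        after : ∀ {n z} → AtL Q n z → z ≢ c
        after zn = uniq-apart U (atL-++ʳ P (there zn)) c-at
                      (λ e → 1+n≢0 (+-cancelˡ-≡ (length P) _ _ e))

    delete-moved : ∀ {P Q P' Q' : List (Fin k)} → All (_≢ c) P → All (_≢ c) Q → All (_≢ c) P' → All (_≢ c) Q' →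
                   P ++ Q ≡ P' ++ Q' → deleteL c (P ++ c ∷ Q) ≡ deleteL c (P' ++ c ∷ Q')
    delete-moved P∌c Q∌c P'∌c Q'∌c e = trans (delete-one P∌c Q∌c) (trans e (sym (delete-one P'∌c Q'∌c)))

    delete-window : ∀ (L W W' R : List (Fin k)) → deleteL c W ≡ deleteL c W' →
                    deleteL c (L ++ W ++ R) ≡ deleteL c (L ++ W' ++ R)
    delete-window L W W' R eq = begin
      deleteL c (L ++ W ++ R)                   ≡⟨ LP.filter-++ keep? L (W ++ R) ⟩
      deleteL c L ++ deleteL c (W ++ R)         ≡⟨ cong (deleteL c L ++_) (LP.filter-++ keep? W R) ⟩
      deleteL c L ++ deleteL c W ++ deleteL c R ≡⟨ cong (λ m → deleteL c L ++ m ++ deleteL c R) eq ⟩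
      deleteL c L ++ deleteL c W' ++ deleteL c R ≡⟨ cong (deleteL c L ++_) (LP.filter-++ keep? W' R) ⟨
      deleteL c L ++ deleteL c (W' ++ R)        ≡⟨ LP.filter-++ keep? L (W' ++ R) ⟨
      deleteL c (L ++ W' ++ R)                  ∎
      where open ≡-Reasoning

    delete-agrees : ∀ {ρ ρ' : Vote k} (L W W' R : List (Fin k)) → toList ρ ≡ L ++ W ++ R → toList ρ' ≡ L ++ W' ++ R →
                    deleteL c W ≡ deleteL c W' → delete c ρ ≡ delete c ρ'
    delete-agrees L W W' R e e' eq = subst₂ (λ l l' → deleteL c l ≡ deleteL c l') (sym e) (sym e') (delete-window L W W' R eq)

  module _ {A : Set} where

    block-split : ∀ {l : List A} {i x y} → AtL l i x → AtL l (suc i) y → ∃[ S₁ ] ∃[ S₂ ] (l ≡ S₁ ++ x ∷ y ∷ S₂)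
    block-split here (there here) = [] , _ , refl
    block-split (there {y = z} p) (there q) with block-split p q
    ... | S₁ , S₂ , refl = z ∷ S₁ , S₂ , refl

    split-at : ∀ (P Q C D : List A) (a : A) → P ++ a ∷ Q ≡ C ++ D →
               (∃[ M ] (C ≡ P ++ a ∷ M × Q ≡ M ++ D)) ⊎ (∃[ M ] (P ≡ C ++ M × D ≡ M ++ a ∷ Q))
    split-at [] Q [] D a e = inj₂ ([] , refl , sym e)
    split-at [] Q (c ∷ C) D a refl = inj₁ (C , refl , refl)
    split-at (x ∷ P) Q [] D a e = inj₂ (x ∷ P , refl , sym e)
    split-at (x ∷ P) Q (c ∷ C) D a e with LP.∷-injective e
    ... | refl , e' with split-at P Q C D a e'
    ...   | inj₁ (M , refl , r) = inj₁ (M , refl , r)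
    ...   | inj₂ (M , refl , r) = inj₂ (M , refl , r)

    unique-split : ∀ (P Q C D : List A) (a : A) → Uniq (P ++ a ∷ Q) → P ++ a ∷ Q ≡ C ++ a ∷ D → P ≡ C × Q ≡ D
    unique-split [] Q [] D a U refl = refl , refl
    unique-split [] Q (c ∷ C) D a U refl with U here (there (atL-++ʳ C here))
    ... | ()
    unique-split (x ∷ P) Q [] D a U refl with U here (there (atL-++ʳ P here))
    ... | ()
    unique-split (x ∷ P) Q (c ∷ C) D a U e with LP.∷-injective e
    ... | refl , e' with unique-split P Q C D a (λ p q → suc-injective (U (there p) (there q))) e'
    ...   | refl , refl = refl , refl

  OffWindow : ∀ {A : Set} → List A → List A → A → Set
  OffWindow L R z = Occurs z L ⊎ Occurs z R

  data EdgeShape {k} (a b : Fin k) (σ π : Vote k) : Set where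
    apart : ∀ L R x y → toList σ ≡ L ++ (x ∷ y ∷ []) ++ R → toList π ≡ L ++ (y ∷ x ∷ []) ++ R →
            OffWindow L R a → OffWindow L R b → EdgeShape a b σ π
    block-rises : ∀ xs ys x → toList σ ≡ xs ++ (x ∷ a ∷ b ∷ []) ++ ys →
                  toList π ≡ xs ++ (a ∷ b ∷ x ∷ []) ++ ys → EdgeShape a b σ π
    third-rises : ∀ xs ys c → toList σ ≡ xs ++ (a ∷ b ∷ c ∷ []) ++ ys →
                  toList π ≡ xs ++ (c ∷ a ∷ b ∷ []) ++ ys → EdgeShape a b σ π

  module _ {k} {a b : Fin k} {σ π : Vote k} where

    shape-from-lists : ∀ S₁ S₂ P₁ P₂ xs ys x y →
                       toList σ ≡ S₁ ++ a ∷ b ∷ S₂ → toList π ≡ P₁ ++ a ∷ b ∷ P₂ →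
                       S₁ ++ a ∷ S₂ ≡ xs ++ x ∷ y ∷ ys → P₁ ++ a ∷ P₂ ≡ xs ++ y ∷ x ∷ ys →
                       Uniq (P₁ ++ a ∷ P₂) → EdgeShape a b σ π
    shape-from-lists S₁ S₂ P₁ P₂ xs ys x y eσ eπ dσ dπ U with split-at S₁ S₂ xs (x ∷ y ∷ ys) a dσ
    ... | inj₁ (M , refl , refl)
      with unique-split P₁ P₂ S₁ (M ++ y ∷ x ∷ ys) a U (trans dπ (LP.++-assoc S₁ (a ∷ M) (y ∷ x ∷ ys)))
    ...   | refl , refl =
            apart (S₁ ++ a ∷ b ∷ M) ys x y (trans eσ (sym (LP.++-assoc S₁ (a ∷ b ∷ M) (x ∷ y ∷ ys))))
                  (trans eπ (sym (LP.++-assoc S₁ (a ∷ b ∷ M) (y ∷ x ∷ ys))))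
                  (inj₁ (_ , atL-++ʳ S₁ here)) (inj₁ (_ , atL-++ʳ S₁ (there here)))
    -- a is the upper element x of the pair, so y rises above the block
    shape-from-lists S₁ S₂ P₁ P₂ xs ys x y eσ eπ dσ dπ U | inj₂ ([] , refl , refl)
      with unique-split P₁ P₂ (xs ++ y ∷ []) ys x U (trans dπ (sym (LP.++-assoc xs (y ∷ []) (x ∷ ys))))
    ...   | refl , refl =
            third-rises xs ys y (trans eσ (cong (_++ x ∷ b ∷ y ∷ ys) (LP.++-identityʳ xs)))
                                (trans eπ (LP.++-assoc xs (y ∷ []) (x ∷ b ∷ ys)))
    -- a is the lower element y of the pair, so the block rises above x
    shape-from-lists S₁ S₂ P₁ P₂ xs ys x y eσ eπ dσ dπ U | inj₂ (m ∷ [] , refl , refl)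
      with unique-split P₁ P₂ xs (x ∷ ys) y U dπ
    ...   | refl , refl = block-rises xs ys x (trans eσ (LP.++-assoc xs (x ∷ []) (y ∷ b ∷ ys))) eπ
    shape-from-lists S₁ S₂ P₁ P₂ xs ys x y eσ eπ dσ dπ U | inj₂ (m ∷ m' ∷ M , refl , refl)
      with unique-split P₁ P₂ (xs ++ y ∷ x ∷ M) S₂ a U (trans dπ (sym (LP.++-assoc xs (y ∷ x ∷ M) (a ∷ S₂))))
    ...   | refl , refl =
            apart xs (M ++ a ∷ b ∷ S₂) x y (trans eσ (LP.++-assoc xs (x ∷ y ∷ M) (a ∷ b ∷ S₂)))
                  (trans eπ (LP.++-assoc xs (y ∷ x ∷ M) (a ∷ b ∷ S₂)))
                  (inj₂ (_ , atL-++ʳ M here)) (inj₂ (_ , atL-++ʳ M (there here)))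

    delete-block : ∀ S₁ S₂ → Uniq (S₁ ++ a ∷ b ∷ S₂) → deleteL b (S₁ ++ a ∷ b ∷ S₂) ≡ S₁ ++ a ∷ S₂
    delete-block S₁ S₂ U = begin
      deleteL b (S₁ ++ a ∷ b ∷ S₂)         ≡⟨ cong (deleteL b) regroup ⟩
      deleteL b ((S₁ ++ a ∷ []) ++ b ∷ S₂) ≡⟨ delete-unique b (S₁ ++ a ∷ []) S₂ (subst Uniq regroup U) ⟩
      (S₁ ++ a ∷ []) ++ S₂                 ≡⟨ LP.++-assoc S₁ (a ∷ []) S₂ ⟩
      S₁ ++ a ∷ S₂                         ∎
      where
        open ≡-Reasoning
        regroup : S₁ ++ a ∷ b ∷ S₂ ≡ (S₁ ++ a ∷ []) ++ b ∷ S₂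
        regroup = sym (LP.++-assoc S₁ (a ∷ []) (b ∷ S₂))

    edge-shape : Fbar a b σ → Fbar a b π → AdjSwapL (delete b σ) (delete b π) → EdgeShape a b σ π
    edge-shape (rσ , _ , aσ , bσ) (rπ , _ , aπ , bπ) (xs , x , y , ys , swσ , swπ)
      with block-split (at⇒atL aσ) (at⇒atL bσ) | block-split (at⇒atL aπ) (at⇒atL bπ)
    ... | S₁ , S₂ , eσ | P₁ , P₂ , eπ =
      shape-from-lists S₁ S₂ P₁ P₂ xs ys x y eσ eπ
        (trans (sym (deleted σ S₁ S₂ rσ eσ)) swσ) (trans (sym (deleted π P₁ P₂ rπ eπ)) swπ)
        (subst Uniq (deleted π P₁ P₂ rπ eπ)
               (allPairs⇒uniq (LAPP.filter⁺ (λ z → ¬? (z F.≟ b)) (vec-allPairs⇒list rπ))))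
      where
        deleted : ∀ ρ S₁ S₂ → IsRanking ρ → toList ρ ≡ S₁ ++ a ∷ b ∷ S₂ → delete b ρ ≡ S₁ ++ a ∷ S₂
        deleted ρ S₁ S₂ r e = trans (cong (deleteL b) e) (delete-block S₁ S₂ (subst Uniq e (ranking-unique r)))

  OneOf3 : ∀ {A : Set} → A → A → A → A → Set
  OneOf3 a b c z = z ≡ a ⊎ z ≡ b ⊎ z ≡ c

  data Arrangement {A : Set} (a b c : A) : A → A → A → Set where
    abc : Arrangement a b c a b c
    acb : Arrangement a b c a c b
    bac : Arrangement a b c b a c
    bca : Arrangement a b c b c a
    cab : Arrangement a b c c a b
    cba : Arrangement a b c c b a

  module _ {A : Set} {a b c : A} where

    arrangement : ∀ {u v w} → OneOf3 a b c u → OneOf3 a b c v → OneOf3 a b c w →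
                  u ≢ v → u ≢ w → v ≢ w → Arrangement a b c u v w
    arrangement (inj₁ refl) (inj₂ (inj₁ refl)) (inj₂ (inj₂ refl)) _ _ _ = abc
    arrangement (inj₁ refl) (inj₂ (inj₂ refl)) (inj₂ (inj₁ refl)) _ _ _ = acb
    arrangement (inj₂ (inj₁ refl)) (inj₁ refl) (inj₂ (inj₂ refl)) _ _ _ = bac
    arrangement (inj₂ (inj₁ refl)) (inj₂ (inj₂ refl)) (inj₁ refl) _ _ _ = bca
    arrangement (inj₂ (inj₂ refl)) (inj₁ refl) (inj₂ (inj₁ refl)) _ _ _ = cab
    arrangement (inj₂ (inj₂ refl)) (inj₂ (inj₁ refl)) (inj₁ refl) _ _ _ = cba
    arrangement (inj₁ refl) (inj₁ refl) _ u≢v _ _ = ⊥-elim (u≢v refl)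
    arrangement (inj₂ (inj₁ refl)) (inj₂ (inj₁ refl)) _ u≢v _ _ = ⊥-elim (u≢v refl)
    arrangement (inj₂ (inj₂ refl)) (inj₂ (inj₂ refl)) _ u≢v _ _ = ⊥-elim (u≢v refl)
    arrangement (inj₁ refl) _ (inj₁ refl) _ u≢w _ = ⊥-elim (u≢w refl)
    arrangement (inj₂ (inj₁ refl)) _ (inj₂ (inj₁ refl)) _ u≢w _ = ⊥-elim (u≢w refl)
    arrangement (inj₂ (inj₂ refl)) _ (inj₂ (inj₂ refl)) _ u≢w _ = ⊥-elim (u≢w refl)
    arrangement _ (inj₁ refl) (inj₁ refl) _ _ v≢w = ⊥-elim (v≢w refl)
    arrangement _ (inj₂ (inj₁ refl)) (inj₂ (inj₁ refl)) _ _ v≢w = ⊥-elim (v≢w refl)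
    arrangement _ (inj₂ (inj₂ refl)) (inj₂ (inj₂ refl)) _ _ v≢w = ⊥-elim (v≢w refl)

    arranged : ∀ {u v w z} → Arrangement a b c u v w → OneOf3 a b c z → OneOf3 u v w z
    arranged abc z∈ = z∈
    arranged acb (inj₁ e) = inj₁ e
    arranged acb (inj₂ (inj₁ e)) = inj₂ (inj₂ e)
    arranged acb (inj₂ (inj₂ e)) = inj₂ (inj₁ e)
    arranged bac (inj₁ e) = inj₂ (inj₁ e)
    arranged bac (inj₂ (inj₁ e)) = inj₁ e
    arranged bac (inj₂ (inj₂ e)) = inj₂ (inj₂ e)
    arranged bca (inj₁ e) = inj₂ (inj₂ e)
    arranged bca (inj₂ (inj₁ e)) = inj₁ e
    arranged bca (inj₂ (inj₂ e)) = inj₂ (inj₁ e)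
    arranged cab (inj₁ e) = inj₂ (inj₁ e)
    arranged cab (inj₂ (inj₁ e)) = inj₂ (inj₂ e)
    arranged cab (inj₂ (inj₂ e)) = inj₁ e
    arranged cba (inj₁ e) = inj₂ (inj₂ e)
    arranged cba (inj₂ (inj₁ e)) = inj₂ (inj₁ e)
    arranged cba (inj₂ (inj₂ e)) = inj₁ e

    occurs-in-triple : ∀ {z} → Occurs z (a ∷ b ∷ c ∷ []) → OneOf3 a b c z
    occurs-in-triple (_ , here) = inj₁ refl
    occurs-in-triple (_ , there here) = inj₂ (inj₁ refl)
    occurs-in-triple (_ , there (there here)) = inj₂ (inj₂ refl)

    triple-positions : ∀ {z} → OneOf3 a b c z → ∃[ i ] (i < 3 × AtL (a ∷ b ∷ c ∷ []) i z)
    triple-positions (inj₁ refl) = 0 , s≤s z≤n , here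
    triple-positions (inj₂ (inj₁ refl)) = 1 , s≤s (s≤s z≤n) , there here
    triple-positions (inj₂ (inj₂ refl)) = 2 , s≤s (s≤s (s≤s z≤n)) , there (there here)

  Triple : ∀ {k} → Fin k → Fin k → Fin k → Subset k
  Triple a b c = ⁅ a ⁆ ∪ ⁅ b ⁆ ∪ ⁅ c ⁆

  module _ {k} {a b c : Fin k} where

    triple⁻ : ∀ {z} → z S.∈ Triple a b c → OneOf3 a b c z
    triple⁻ z∈ with SP.x∈p∪q⁻ ⁅ a ⁆ (⁅ b ⁆ ∪ ⁅ c ⁆) z∈
    ... | inj₁ z∈a = inj₁ (SP.x∈⁅y⁆⇒x≡y a z∈a)
    ... | inj₂ z∈bc with SP.x∈p∪q⁻ ⁅ b ⁆ ⁅ c ⁆ z∈bc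
    ...   | inj₁ z∈b = inj₂ (inj₁ (SP.x∈⁅y⁆⇒x≡y b z∈b))
    ...   | inj₂ z∈c = inj₂ (inj₂ (SP.x∈⁅y⁆⇒x≡y c z∈c))

    triple⁺ : ∀ {z} → OneOf3 a b c z → z S.∈ Triple a b c
    triple⁺ (inj₁ refl) = SP.x∈p∪q⁺ (inj₁ (SP.x∈⁅x⁆ a))
    triple⁺ (inj₂ (inj₁ refl)) = SP.x∈p∪q⁺ {p = ⁅ a ⁆} (inj₂ (SP.x∈p∪q⁺ (inj₁ (SP.x∈⁅x⁆ b))))
    triple⁺ (inj₂ (inj₂ refl)) =
      SP.x∈p∪q⁺ {p = ⁅ a ⁆} (inj₂ (SP.x∈p∪q⁺ {p = ⁅ b ⁆} (inj₂ (SP.x∈⁅x⁆ c))))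

  size-insert : ∀ {n} (x : Fin n) (p : Subset n) → ¬ (x S.∈ p) → ∣ ⁅ x ⁆ ∪ p ∣ ≡ suc ∣ p ∣
  size-insert F.zero (true ∷ p) x∉p = ⊥-elim (x∉p VB.here)
  size-insert F.zero (false ∷ p) x∉p = cong suc (cong ∣_∣ (SP.∪-identityˡ p))
  size-insert (F.suc x) (true ∷ p) x∉p = cong suc (size-insert x p (x∉p ∘ VB.there))
  size-insert (F.suc x) (false ∷ p) x∉p = size-insert x p (x∉p ∘ VB.there)

  triple-size : ∀ {k} {a b c : Fin k} → a ≢ b → a ≢ c → b ≢ c → ∣ Triple a b c ∣ ≡ 3
  triple-size {a = a} {b} {c} a≢b a≢c b≢c =
    trans (size-insert a _ a∉bc)
          (cong suc (trans (size-insert b _ (b≢c ∘ SP.x∈⁅y⁆⇒x≡y c)) (cong suc (SP.∣⁅x⁆∣≡1 c))))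
    where
      a∉bc : ¬ (a S.∈ ⁅ b ⁆ ∪ ⁅ c ⁆)
      a∉bc a∈ with SP.x∈p∪q⁻ ⁅ b ⁆ ⁅ c ⁆ a∈
      ... | inj₁ a∈b = a≢b (SP.x∈⁅y⁆⇒x≡y b a∈b)
      ... | inj₂ a∈c = a≢c (SP.x∈⁅y⁆⇒x≡y c a∈c)

  same-list⇒same-vote : ∀ {k} (τ ρ : Vote k) → toList τ ≡ toList ρ → τ ≡ ρ
  same-list⇒same-vote τ ρ e = trans (sym (cast-is-id refl τ)) (VP.toList-injective refl τ ρ e)

  TopOutcomes : ∀ {k} → SCF k → List (Fin k) → List (Fin k) → Fin k → Fin k → Fin k → Set
  TopOutcomes {k} f xs ys a b c = ∀ {u v w} → Arrangement a b c u v w →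
    Σ (Vote k) λ ρ → toList ρ ≡ xs ++ (u ∷ v ∷ w ∷ []) ++ ys × f ρ ≡ u

  -- If σ = xs a b c ys and f elects the top of the window for all six arrangements, then σ is a
  -- local dictator on {a, b, c}: a ranking agreeing with σ outside the window is one of the six.
  window-dictator : ∀ {k} (f : SCF k) {σ : Vote k} {a b c} (xs ys : List (Fin k)) → IsRanking σ →
                    toList σ ≡ xs ++ (a ∷ b ∷ c ∷ []) ++ ys → TopOutcomes f xs ys a b c →
                    LDon f (Triple a b c) σ
  window-dictator f {σ} {a} {b} {c} xs ys rσ eσ tops = length xs , members , dictates
    where
      H : Subset _
      H = Triple a b c
      Uσ : Uniq (xs ++ (a ∷ b ∷ c ∷ []) ++ ys)
      Uσ = subst Uniq eσ (ranking-unique rσ)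
      size : ∣ H ∣ ≡ 3
      size = triple-size (window-vs-window xs _ ys Uσ here (there here) (λ ()))
                         (window-vs-window xs _ ys Uσ here (there (there here)) (λ ()))
                         (window-vs-window xs _ ys Uσ (there here) (there (there here)) (λ ()))

      members : ∀ x → x S.∈ H → ∃[ j ] (length xs ≤ j × j < length xs + ∣ H ∣ × At σ j x)
      members x x∈H with triple-positions (triple⁻ x∈H)
      ... | i , i<3 , xi = length xs + i , m≤m+n _ i ,
                           subst (λ s → length xs + i < length xs + s) (sym size) (+-monoʳ-< (length xs) i<3) ,
                           atL⇒at (along (sym eσ) (atL-++ʳ xs (atL-++ˡ xi)))

      dictates : ∀ τ → IsRanking τ → (∀ j x → Outside (length xs) ∣ H ∣ j → At σ j x → At τ j x) →
                 IsTop H τ (f τ)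
      dictates τ rτ agree
        with splice xs (a ∷ b ∷ c ∷ []) ys (toList τ)
               (trans (VP.length-toList τ) (trans (sym (VP.length-toList σ)) (cong length eσ)))
               (λ n x out p → at⇒atL (agree n x (subst (λ s → Outside (length xs) s n) (sym size) out)
                                              (atL⇒at (along (sym eσ) p))))
      ... | [] , () , _
      ... | _ ∷ [] , () , _
      ... | _ ∷ _ ∷ [] , () , _
      ... | _ ∷ _ ∷ _ ∷ _ ∷ _ , () , _
      ... | u ∷ v ∷ w ∷ [] , _ , eτ = subst (IsTop H τ) (sym outcome) (triple⁺ (member here) , above)
        where
          Uτ : Uniq (xs ++ (u ∷ v ∷ w ∷ []) ++ ys)
          Uτ = subst Uniq eτ (ranking-unique rτ)
          position : ∀ {i z} → AtL (u ∷ v ∷ w ∷ []) i z → AtL (toList τ) (length xs + i) z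
          position zi = along (sym eτ) (atL-++ʳ xs (atL-++ˡ zi))
          member : ∀ {i z} → AtL (u ∷ v ∷ w ∷ []) i z → OneOf3 a b c z
          member {z = z} zi = occurs-in-triple (window-members xs _ _ ys refl Uτ
                                (subst (Occurs z) eσ (ranking-complete rσ z)) (_ , zi))
          arr : Arrangement a b c u v w
          arr = arrangement (member here) (member (there here)) (member (there (there here)))
                  (window-vs-window xs _ ys Uτ here (there here) (λ ()))
                  (window-vs-window xs _ ys Uτ here (there (there here)) (λ ()))
                  (window-vs-window xs _ ys Uτ (there here) (there (there here)) (λ ()))
          outcome : f τ ≡ u
          outcome with tops arr
          ... | ρ , eρ , fρ≡u = trans (cong f (same-list⇒same-vote τ ρ (trans eτ (sym eρ)))) fρ≡u
          top-first : ∀ {i} → length xs + 0 < length xs + suc i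
          top-first = +-monoʳ-< (length xs) (s≤s z≤n)
          above : ∀ z → z S.∈ H → z ≢ u → Above τ u z
          above z z∈H z≢u with arranged arr (triple⁻ z∈H)
          ... | inj₁ refl = ⊥-elim (z≢u refl)
          ... | inj₂ (inj₁ refl) = aboveL⇒above (_ , _ , top-first , position here , position (there here))
          ... | inj₂ (inj₂ refl) = aboveL⇒above (_ , _ , top-first , position here , position (there (there here)))

  module Boundary {k} (f : SCF k) (a b : Fin k) (σ π : Vote k) (rσ : IsRanking σ) (rπ : IsRanking π)
                  (fσ : f σ ≡ a) (fσab : f ([ a ∶ b ] σ) ≡ b) (π∉B : ¬ (f π ≡ a × f ([ a ∶ b ] π) ≡ b)) where

    σab πab : Vote k
    σab = [ a ∶ b ] σ
    πab = [ a ∶ b ] π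

    rσab : IsRanking σab
    rσab = swap-ranking a b rσ
    rπab : IsRanking πab
    rπab = swap-ranking a b rπ

    private
      sw : Fin k → Fin k
      sw = swapVal a b

    Shifted : Fin k → Vote k → Set
    Shifted c σ̂ = delete c σ̂ ≡ delete c σ ⊎ delete c σ̂ ≡ delete c σab

    ShiftedManipulation : Set
    ShiftedManipulation = ∃[ σ̂ ] ∃[ c ] (ManipPoint 3 f σ̂ × c ≢ a × c ≢ b × Shifted c σ̂)

    shifted : ∀ {c σ̂} → c ≢ a → c ≢ b → Shifted c σ̂ → ManipPoint 3 f σ̂ → ShiftedManipulation
    shifted c≢a c≢b sh m = _ , _ , m , c≢a , c≢b , sh

    settle : ∀ {P M M' : Set} → (M → ShiftedManipulation) → (M' → ShiftedManipulation) →
             P ⊎ M ⊎ M' → P ⊎ ShiftedManipulation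
    settle _ _ (inj₁ p) = inj₁ p
    settle m _ (inj₂ (inj₁ x)) = inj₂ (m x)
    settle _ m' (inj₂ (inj₂ x)) = inj₂ (m' x)

    leave-B : f π ≡ a ⊎ ShiftedManipulation → f πab ≡ b ⊎ ShiftedManipulation → ShiftedManipulation
    leave-B (inj₂ sm) _ = sm
    leave-B (inj₁ _) (inj₂ sm) = sm
    leave-B (inj₁ fπ≡a) (inj₁ fπab≡b) = ⊥-elim (π∉B (fπ≡a , fπab≡b))

    -- The transposed pair x y lies away from the block: by the window lemma π and [a:b]π keep
    -- the outcomes a and b, unless a manipulation point appears; deleting x undoes the change.
    apart-case : ∀ L R x y → toList σ ≡ L ++ (x ∷ y ∷ []) ++ R → toList π ≡ L ++ (y ∷ x ∷ []) ++ R →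
                 OffWindow L R a → OffWindow L R b → ShiftedManipulation
    apart-case L R x y eσ eπ off-a off-b = leave-B π-keeps-a πab-keeps-b
      where
        Uσ : Uniq (L ++ (x ∷ y ∷ []) ++ R)
        Uσ = subst Uniq eσ (ranking-unique rσ)
        off-window : ∀ {z i w} → OffWindow L R z → AtL (x ∷ y ∷ []) i w → w ≢ z
        off-window (inj₁ (_ , zn)) wi = ≢-sym (window-vs-front L _ R Uσ zn wi)
        off-window (inj₂ (_ , zn)) wi = ≢-sym (window-vs-back L _ R Uσ zn wi)
        x≢a : x ≢ a
        x≢a = off-window off-a here
        x≢b : x ≢ b
        x≢b = off-window off-b here
        y≢x : y ≢ x
        y≢x = window-vs-window L _ R Uσ (there here) here (λ ())

        -- [a:b] fixes x and y, so it keeps the windows of σ and π in place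
        swapped : ∀ {ρ} W → toList ρ ≡ L ++ W ++ R → L.map sw W ≡ W →
                  toList ([ a ∶ b ] ρ) ≡ L.map sw L ++ W ++ L.map sw R
        swapped W e fixW = trans (swap-split a b L W R e) (cong (λ V → L.map sw L ++ V ++ L.map sw R) fixW)
        sx : sw x ≡ x
        sx = swap-other a b x≢a x≢b
        sy : sw y ≡ y
        sy = swap-other a b (off-window off-a (there here)) (off-window off-b (there here))
        eσab : toList σab ≡ L.map sw L ++ (x ∷ y ∷ []) ++ L.map sw R
        eσab = swapped (x ∷ y ∷ []) eσ (cong₂ (λ s t → s ∷ t ∷ []) sx sy)
        eπab : toList πab ≡ L.map sw L ++ (y ∷ x ∷ []) ++ L.map sw R
        eπab = swapped (y ∷ x ∷ []) eπ (cong₂ (λ s t → s ∷ t ∷ []) sy sx)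

        undo : ∀ {ρ ρ'} L' R' → toList ρ ≡ L' ++ (y ∷ x ∷ []) ++ R' → toList ρ' ≡ L' ++ (x ∷ y ∷ []) ++ R' →
               delete x ρ ≡ delete x ρ'
        undo L' R' e e' = delete-agrees x L' _ _ R' e e'
          (delete-moved x (y≢x LAll.∷ LAll.[]) LAll.[] LAll.[] (y≢x LAll.∷ LAll.[]) refl)

        π-keeps-a : f π ≡ a ⊎ ShiftedManipulation
        π-keeps-a = settle (shifted x≢a x≢b (inj₁ (undo L R eπ eσ))) (shifted x≢a x≢b (inj₁ refl))
                      (keeps-outside-outcome f (window L _ _ R eπ eσ refl (n≤1+n 2)) rπ rσ fσ off-a)
        off-swapped : ∀ {z} → OffWindow L R z → OffWindow (L.map sw L) (L.map sw R) (sw z)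
        off-swapped (inj₁ (n , zn)) = inj₁ (n , atL-map sw zn)
        off-swapped (inj₂ (n , zn)) = inj₂ (n , atL-map sw zn)
        πab-keeps-b : f πab ≡ b ⊎ ShiftedManipulation
        πab-keeps-b = settle (shifted x≢a x≢b (inj₂ (undo _ _ eπab eσab))) (shifted x≢a x≢b (inj₂ refl))
                        (keeps-outside-outcome f (window _ _ _ _ eπab eσab refl (n≤1+n 2)) rπab rσab fσab
                           (subst (OffWindow _ _) (swap-left a b) (off-swapped off-a)))

    -- The block ab rises above x: π and [a:b]π have a resp. b on top of the window, so the
    -- window lemma lets them keep those outcomes unless a manipulation point appears.
    block-rises-case : ∀ xs ys x → toList σ ≡ xs ++ (x ∷ a ∷ b ∷ []) ++ ys →
                       toList π ≡ xs ++ (a ∷ b ∷ x ∷ []) ++ ys → ShiftedManipulation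
    block-rises-case xs ys x eσ eπ = leave-B π-keeps-a πab-keeps-b
      where
        Uσ : Uniq (xs ++ (x ∷ a ∷ b ∷ []) ++ ys)
        Uσ = subst Uniq eσ (ranking-unique rσ)
        Uπ : Uniq (xs ++ (a ∷ b ∷ x ∷ []) ++ ys)
        Uπ = subst Uniq eπ (ranking-unique rπ)
        x≢a : x ≢ a
        x≢a = window-vs-window xs _ ys Uσ here (there here) (λ ())
        x≢b : x ≢ b
        x≢b = window-vs-window xs _ ys Uσ here (there (there here)) (λ ())
        sx : sw x ≡ x
        sx = swap-other a b x≢a x≢b

        eσab : toList σab ≡ xs ++ (x ∷ b ∷ a ∷ []) ++ ys
        eσab = trans (swap-inside xs _ ys Uσ eσ (_ , there here) (_ , there (there here)))
                     (cong (λ W → xs ++ W ++ ys) (map-triple sw x a b sx (swap-left a b) (swap-right a b)))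
        eπab : toList πab ≡ xs ++ (b ∷ a ∷ x ∷ []) ++ ys
        eπab = trans (swap-inside xs _ ys Uπ eπ (_ , here) (_ , there here))
                     (cong (λ W → xs ++ W ++ ys) (map-triple sw a b x (swap-left a b) (swap-right a b) sx))

        drop-x : ∀ {ρ ρ' u v} → u ≢ x → v ≢ x → toList ρ ≡ xs ++ (u ∷ v ∷ x ∷ []) ++ ys →
                 toList ρ' ≡ xs ++ (x ∷ u ∷ v ∷ []) ++ ys → delete x ρ ≡ delete x ρ'
        drop-x u≢x v≢x e e' = delete-agrees x xs _ _ ys e e'
          (delete-moved x (u≢x LAll.∷ v≢x LAll.∷ LAll.[]) LAll.[] LAll.[] (u≢x LAll.∷ v≢x LAll.∷ LAll.[]) refl)

        π-keeps-a : f π ≡ a ⊎ ShiftedManipulation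
        π-keeps-a = settle (shifted x≢a x≢b (inj₁ (drop-x (≢-sym x≢a) (≢-sym x≢b) eπ eσ)))
                           (shifted x≢a x≢b (inj₁ refl))
                      (keeps-top-outcome f (window xs _ _ ys eπ eσ refl ≤-refl) rπ rσ fσ here)
        πab-keeps-b : f πab ≡ b ⊎ ShiftedManipulation
        πab-keeps-b = settle (shifted x≢a x≢b (inj₂ (drop-x (≢-sym x≢b) (≢-sym x≢a) eπab eσab)))
                             (shifted x≢a x≢b (inj₂ refl))
                        (keeps-top-outcome f (window xs _ _ ys eπab eσab refl ≤-refl) rπab rσab fσab here)

    -- A third alternative c rises above the block.  Either a manipulation point appears, or f
    -- elects the top of the window for all six arrangements of a, b, c: σ ∈ LD^{a,b,c}.
    third-rises-case : ∀ xs ys c → toList σ ≡ xs ++ (a ∷ b ∷ c ∷ []) ++ ys →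
                       toList π ≡ xs ++ (c ∷ a ∷ b ∷ []) ++ ys → LDab f a b σ ⊎ ShiftedManipulation
    third-rises-case xs ys c eσ eπ = conclude π-outcome πab-outcome
      where
        Uσ : Uniq (xs ++ (a ∷ b ∷ c ∷ []) ++ ys)
        Uσ = subst Uniq eσ (ranking-unique rσ)
        Uπ : Uniq (xs ++ (c ∷ a ∷ b ∷ []) ++ ys)
        Uπ = subst Uniq eπ (ranking-unique rπ)
        a≢b : a ≢ b
        a≢b = window-vs-window xs _ ys Uσ here (there here) (λ ())
        a≢c : a ≢ c
        a≢c = window-vs-window xs _ ys Uσ here (there (there here)) (λ ())
        b≢c : b ≢ c
        b≢c = window-vs-window xs _ ys Uσ (there here) (there (there here)) (λ ())
        c≢a : c ≢ a
        c≢a = ≢-sym a≢c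
        c≢b : c ≢ b
        c≢b = ≢-sym b≢c

        eσab : toList σab ≡ xs ++ (b ∷ a ∷ c ∷ []) ++ ys
        eσab = trans (swap-inside xs _ ys Uσ eσ (_ , here) (_ , there here))
                     (cong (λ W → xs ++ W ++ ys) (map-triple sw a b c (swap-left a b) (swap-right a b) (swap-other a b c≢a c≢b)))
        eπab : toList πab ≡ xs ++ (c ∷ b ∷ a ∷ []) ++ ys
        eπab = trans (swap-inside xs _ ys Uπ eπ (_ , there here) (_ , there (there here)))
                     (cong (λ W → xs ++ W ++ ys) (map-triple sw c a b (swap-other a b c≢a c≢b) (swap-left a b) (swap-right a b)))
        σacb σbca : Vote k
        σacb = [ b ∶ c ] σ
        σbca = [ a ∶ b ] σacb
        racb : IsRanking σacb
        racb = swap-ranking b c rσ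
        rbca : IsRanking σbca
        rbca = swap-ranking a b racb
        eacb : toList σacb ≡ xs ++ (a ∷ c ∷ b ∷ []) ++ ys
        eacb = trans (swap-inside xs _ ys Uσ eσ (_ , there here) (_ , there (there here)))
                     (cong (λ W → xs ++ W ++ ys)
                           (map-triple (swapVal b c) a b c (swap-other b c a≢b a≢c) (swap-left b c) (swap-right b c)))
        ebca : toList σbca ≡ xs ++ (b ∷ c ∷ a ∷ []) ++ ys
        ebca = trans (swap-inside xs _ ys (subst Uniq eacb (ranking-unique racb)) eacb (_ , here) (_ , there (there here)))
                     (cong (λ W → xs ++ W ++ ys) (map-triple sw a c b (swap-left a b) (swap-other a b c≢a c≢b) (swap-right a b)))

        -- after deleting c, each arrangement is σ or [a:b]σ
        drop-c : ∀ {ρ ρ'} {P Q P' Q' : List (Fin k)} → All (_≢ c) P → All (_≢ c) Q → All (_≢ c) P' → All (_≢ c) Q' →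
                 P ++ Q ≡ P' ++ Q' → toList ρ ≡ xs ++ (P ++ c ∷ Q) ++ ys → toList ρ' ≡ xs ++ (P' ++ c ∷ Q') ++ ys →
                 delete c ρ ≡ delete c ρ'
        drop-c P∌c Q∌c P'∌c Q'∌c e eρ eρ' = delete-agrees c xs _ _ ys eρ eρ' (delete-moved c P∌c Q∌c P'∌c Q'∌c e)
        a,b∌c : All (_≢ c) (a ∷ b ∷ [])
        a,b∌c = a≢c LAll.∷ b≢c LAll.∷ LAll.[]
        b,a∌c : All (_≢ c) (b ∷ a ∷ [])
        b,a∌c = b≢c LAll.∷ a≢c LAll.∷ LAll.[]
        none : All (_≢ c) []
        none = LAll.[]

        at-π : ManipPoint 3 f π → ShiftedManipulation
        at-π = shifted c≢a c≢b (inj₁ (drop-c none a,b∌c a,b∌c none refl eπ eσ))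
        at-πab : ManipPoint 3 f πab → ShiftedManipulation
        at-πab = shifted c≢a c≢b (inj₂ (drop-c none b,a∌c b,a∌c none refl eπab eσab))
        at-σ : ManipPoint 3 f σ → ShiftedManipulation
        at-σ = shifted c≢a c≢b (inj₁ refl)
        at-σab : ManipPoint 3 f σab → ShiftedManipulation
        at-σab = shifted c≢a c≢b (inj₂ refl)
        at-acb : ManipPoint 3 f σacb → ShiftedManipulation
        at-acb = shifted c≢a c≢b (inj₁ (drop-c (a≢c LAll.∷ LAll.[]) (b≢c LAll.∷ LAll.[]) a,b∌c none refl eacb eσ))
        at-bca : ManipPoint 3 f σbca → ShiftedManipulation
        at-bca = shifted c≢a c≢b (inj₂ (drop-c (b≢c LAll.∷ LAll.[]) (a≢c LAll.∷ LAll.[]) b,a∌c none refl ebca eσab))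

        -- a and b are second in the windows of π and [a:b]π, whose top is c
        π-outcome : (f π ≡ a ⊎ f π ≡ c) ⊎ ShiftedManipulation
        π-outcome = settle at-π at-σ
          (keeps-second-outcome f (window xs _ _ ys eπ eσ refl ≤-refl) rπ rσ fσ (there here) here)
        πab-outcome : (f πab ≡ b ⊎ f πab ≡ c) ⊎ ShiftedManipulation
        πab-outcome = settle at-πab at-σab
          (keeps-second-outcome f (window xs _ _ ys eπab eσab refl ≤-refl) rπab rσab fσab (there here) here)

        all-tops : ∀ ρ Wc → IsRanking ρ → toList ρ ≡ xs ++ (c ∷ Wc) ++ ys → length Wc ≡ 2 → f ρ ≡ c →
                   (ManipPoint 3 f ρ → ShiftedManipulation) → TopOutcomes f xs ys a b c ⊎ ShiftedManipulation
        all-tops ρ Wc r e width fρ at-ρ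
          with settle at-π at-ρ (keeps-top-outcome f (window xs _ _ ys eπ e (cong suc (sym width)) ≤-refl) rπ r fρ here)
             | settle at-πab at-ρ (keeps-top-outcome f (window xs _ _ ys eπab e (cong suc (sym width)) ≤-refl) rπab r fρ here)
             | settle at-acb at-σ (keeps-top-outcome f (window xs _ _ ys eacb eσ refl ≤-refl) racb rσ fσ here)
             | settle at-bca at-σab (keeps-top-outcome f (window xs _ _ ys ebca eσab refl ≤-refl) rbca rσab fσab here)
        ... | inj₂ sm | _ | _ | _ = inj₂ sm
        ... | _ | inj₂ sm | _ | _ = inj₂ sm
        ... | _ | _ | inj₂ sm | _ = inj₂ sm
        ... | _ | _ | _ | inj₂ sm = inj₂ sm
        ... | inj₁ fπ≡c | inj₁ fπab≡c | inj₁ facb≡a | inj₁ fbca≡b = inj₁ tops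
          where
            tops : TopOutcomes f xs ys a b c
            tops abc = σ , eσ , fσ
            tops acb = σacb , eacb , facb≡a
            tops bac = σab , eσab , fσab
            tops bca = σbca , ebca , fbca≡b
            tops cab = π , eπ , fπ≡c
            tops cba = πab , eπab , fπab≡c

        dictator : TopOutcomes f xs ys a b c ⊎ ShiftedManipulation → LDab f a b σ ⊎ ShiftedManipulation
        dictator (inj₁ tops) = inj₁ (c , c≢a , c≢b , window-dictator f xs ys rσ eσ tops)
        dictator (inj₂ sm) = inj₂ sm

        conclude : (f π ≡ a ⊎ f π ≡ c) ⊎ ShiftedManipulation → (f πab ≡ b ⊎ f πab ≡ c) ⊎ ShiftedManipulation →
                   LDab f a b σ ⊎ ShiftedManipulation
        conclude (inj₂ sm) _ = inj₂ sm
        conclude _ (inj₂ sm) = inj₂ sm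
        conclude (inj₁ (inj₂ fπ≡c)) _ = dictator (all-tops π _ rπ eπ refl fπ≡c at-π)
        conclude _ (inj₁ (inj₂ fπab≡c)) = dictator (all-tops πab _ rπab eπab refl fπab≡c at-πab)
        conclude (inj₁ (inj₁ fπ≡a)) (inj₁ (inj₁ fπab≡b)) = ⊥-elim (π∉B (fπ≡a , fπab≡b))

    resolve : EdgeShape a b σ π → LDab f a b σ ⊎ ShiftedManipulation
    resolve (apart L R x y eσ eπ off-a off-b) = inj₂ (apart-case L R x y eσ eπ off-a off-b)
    resolve (block-rises xs ys x eσ eπ) = inj₂ (block-rises-case xs ys x eσ eπ)
    resolve (third-rises xs ys c eσ eπ) = third-rises-case xs ys c eσ eπ

open import Defs
open import Data.Nat using (ℕ; _≤_)
open import Data.Fin using (Fin)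
open import Data.Rational using (ℚ; 0ℚ; _<_)
open import Data.Product using (∃-syntax; _×_; _,_; proj₁)
open import Data.Sum using (_⊎_)
open import Relation.Binary.PropositionalEquality using (_≡_; _≢_)
open Proof using (edge-shape; module Boundary)

lemma6p4 : (k : ℕ) → 3 ≤ k → (ε : ℚ) → 0ℚ < ε →
    (f : SCF k) → DistNonManipGE f ε →
    (a b : Fin k) → a ≢ b →
    (σ : Vote k) → IsRanking σ → ∂B f a b σ →
    LDab f a b σ
    ⊎ (∃[ σ̂ ] ∃[ c ] (ManipPoint 3 f σ̂ × c ≢ a × c ≢ b
        × (delete c σ̂ ≡ delete c σ ⊎ delete c σ̂ ≡ delete c ([ a ∶ b ] σ))))
lemma6p4 k _ ε _ f _ a b _ σ rσ ((Fσ , fσ , fσab) , π , (_ , Fπ , transposition) , π∉B) =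
  Boundary.resolve f a b σ π rσ (proj₁ Fπ) fσ fσab (λ { (fπ≡a , fπab≡b) → π∉B (Fπ , fπ≡a , fπab≡b) })
    (edge-shape Fσ Fπ transposition)
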